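{- Let $B = M \cup \{\omega_1,\ldots,\omega_p\}$ be a basis, where $M$ is the set of all monotone Boolean functions, $p\ge1$, and $\omega_1,\ldots,\omega_p$ are non-monotone Boolean functions, and let $r(B)=\max\{d(\omega_1),\ldots,d(\omega_p)\}$. Then for every system $F=\{f_1(x_1,\ldots,x_n),\ldots,f_m(x_1,\ldots,x_n)\}$ of Boolean functions $$d(F)\le (2r(B)+1)\left(2^{I_B(F)}-1\right).$$
   Context: Boolean functions are maps $E_2^n\to E_2$ with $E_2=\{0,1\}$. An increasing chain is a sequence of pairwise distinct tuples $\tilde\alpha_1,\ldots,\tilde\alpha_r\in E_2^n$ with $\tilde\alpha_i\le\tilde\alpha_{i+1}$ componentwise for $i=1,\ldots,r-1$. For a Boolean function $f$, an ordered pair $(\tilde\alpha,\tilde\beta)$ of tuples in $E_2^n$ is a jump of $f$ if $\tilde\alpha\le\tilde\beta$ componentwise and $f(\tilde\alpha)>f(\tilde\beta)$. For a system $F$ of Boolean functions of $x_1,\ldots,x_n$, a pair is a jump for $F$ if it is a jump for some $f\in F$. For a chain $C=(\tilde\alpha_1,\ldots,\tilde\alpha_r)$, $d_C(F)$ is the number of indices $i\in\{1,\ldots,r-1\}$ such that $(\tilde\alpha_i,\tilde\alpha_{i+1})$ is a jump for $F$; the decrease $d(F)$ is the maximum of $d_C(F)$ over all increasing chains $C$, and $d(f)=d(\{f\})$. Circuits over $B$ have gates computing functions of $B$; gates computing functions of $M$ have weight $0$, gates computing $\omega_1,\ldots,\omega_p$ have weight $1$. The inversion complexity $I_B(F)$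 is the minimum, over all circuits over $B$ with inputs $x_1,\ldots,x_n$ realizing all functions of $F$, of the number of gates computing functions from $\{\omega_1,\ldots,\omega_p\}$. -}

module Defs where

open import Data.Bool using (Bool; true; false; if_then_else_)
import Data.Bool as B
import Data.Bool.Properties as BP
open import Data.Nat using (ℕ; zero; suc; _+_; _≤_; _⊔_)
open import Data.Fin using (Fin)
import Data.Fin as F
open import Data.Fin.Properties using (any?)
open import Data.Vec using (Vec; lookup; _∷ʳ_; map)
open import Data.Vec.Relation.Binary.Pointwise.Inductive using (Pointwise)
import Data.Vec.Relation.Binary.Pointwise.Inductive as PW
open import Data.List using (List; []; _∷_)
open import Data.List.Relation.Unary.Linked using (Linked)
open import Data.List.Relation.Unary.Unique.Propositional using (Unique)
open import Data.Product using (Σ; ∃; _×_; _,_)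
open import Relation.Nullary using (¬_; Dec; yes; no)
open import Relation.Nullary.Decidable using (isYes; _×-dec_)
open import Relation.Binary.PropositionalEquality using (_≡_)
open import Function using (_∘_)

BF : ℕ → Set
BF n = Vec Bool n → Bool

_≤ᵥ_ : ∀ {n} → Vec Bool n → Vec Bool n → Set
_≤ᵥ_ = Pointwise B._≤_

_≤ᵥ?_ : ∀ {n} (a b : Vec Bool n) → Dec (a ≤ᵥ b)
_≤ᵥ?_ = PW.decidable BP._≤?_

Monotone : ∀ {k} → BF k → Set
Monotone f = ∀ a b → a ≤ᵥ b → f a B.≤ f b

System : ℕ → ℕ → Set
System n m = Fin m → BF n

IsJump : ∀ {n} → BF n → Vec Bool n → Vec Bool n → Set
IsJump f α β = α ≤ᵥ β × (f α ≡ true × f β ≡ false)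

isJump? : ∀ {n} (f : BF n) (α β : Vec Bool n) → Dec (IsJump f α β)
isJump? f α β = (α ≤ᵥ? β) ×-dec ((f α B.≟ true) ×-dec (f β B.≟ false))

IsJumpSys : ∀ {n m} → System n m → Vec Bool n → Vec Bool n → Set
IsJumpSys F α β = ∃ λ j → IsJump (F j) α β

isJumpSys? : ∀ {n m} (F : System n m) (α β : Vec Bool n) → Dec (IsJumpSys F α β)
isJumpSys? F α β = any? (λ j → isJump? (F j) α β)

IsChain : ∀ {n} → List (Vec Bool n) → Set
IsChain C = Unique C × Linked _≤ᵥ_ C

dC : ∀ {n m} → System n m → List (Vec Bool n) → ℕ
dC F (a ∷ b ∷ rest) = (if isYes (isJumpSys? F a b) then 1 else 0) + dC F (b ∷ rest)
dC F _ = 0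

IsDecrease : ∀ {n m} → System n m → ℕ → Set
IsDecrease {n} F d =
  (∃ λ (C : List (Vec Bool n)) → IsChain C × dC F C ≡ d)
  × (∀ (C : List (Vec Bool n)) → IsChain C → dC F C ≤ d)

maxFin : ∀ {p} → (Fin p → ℕ) → ℕ
maxFin {zero} f = 0
maxFin {suc p} f = f F.zero ⊔ maxFin (f ∘ F.suc)

record Basis : Set₁ where
  field
    p       : ℕ
    p≥1     : 1 ≤ p
    arity   : Fin p → ℕ
    ω       : (i : Fin p) → BF (arity i)
    nonmono : (i : Fin p) → ¬ Monotone (ω i)

module _ (Bs : Basis) where
  open Basis Bs

  data GateFun : ℕ → Set where
    mono  : ∀ {k} (g : BF k) → Monotone g → GateFun k
    omega : (i : Fin p) → GateFun (arity i)

  gateEval : ∀ {k} → GateFun k → BF k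
  gateEval (mono g _) = g
  gateEval (omega i) = ω i

  gateWeight : ∀ {k} → GateFun k → ℕ
  gateWeight (mono _ _) = 0
  gateWeight (omega _) = 1

  record Gate (j : ℕ) : Set where
    constructor gate
    field
      ar   : ℕ
      fun  : GateFun ar
      args : Vec (Fin j) ar

  -- circuit over B with inputs x₁…xₙ and j nodes in total (inputs + gates),
  -- given in topological order
  data Circuit (n : ℕ) : ℕ → Set where
    inputs : Circuit n n
    _▷_    : ∀ {j} → Circuit n j → Gate j → Circuit n (suc j)

  values : ∀ {n j} → Circuit n j → Vec Bool n → Vec Bool j
  values inputs x = x
  values (c ▷ gate _ g as) x =
    let v = values c x in v ∷ʳ gateEval g (map (lookup v) as)

  weight : ∀ {n j} → Circuit n j → ℕ
  weight inputs = 0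
  weight (c ▷ gate _ g _) = weight c + gateWeight g

  Realizes : ∀ {n j m} → Circuit n j → System n m → Set
  Realizes {n} {j} c F = ∀ t → ∃ λ (v : Fin j) → ∀ (x : Vec Bool n) → lookup (values c x) v ≡ F t x

  IsInvComplexity : ∀ {n m} → System n m → ℕ → Set
  IsInvComplexity {n} F k =
    (∃ λ j → Σ (Circuit n j) λ c → Realizes c F × weight c ≡ k)
    × (∀ j (c : Circuit n j) → Realizes c F → k ≤ weight c)

  -- r(B) = d is expressed by giving d(ωᵢ) for each i and taking the maximum
  IsSingleDecrease : (i : Fin p) → ℕ → Set
  IsSingleDecrease i d = IsDecrease {m = 1} (λ _ → ω i) d

-- Fix a circuit realizing F with k ω-gates and call the vector of ω-gate outputs on an input its
-- signature. Between comparable inputs with the same signature every gate, hence every function of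
-- F, is monotone, so along an increasing chain every jump of F is a change of signature. Add the
-- ω-gates one at a time. The new output bit y can only change at steps where the old signature
-- (w bits) stays the same; grouping the chain by old signature gives at most 2^w classes, on each of
-- which the inputs of the new gate increase, so y changes there at most 2 d(ω) + 1 ≤ 2 r(B) + 1 = K
-- times. Hence s(w + 1) ≤ s(w) + K 2^w for the number s(w) of signature changes, and s(k) ≤ K (2^k − 1).

module Submission where

open import Defs
open import Data.Nat using (ℕ; _+_; _*_; _∸_; _^_; _≤_)
open import Data.Fin using (Fin)

open import Data.Bool as Bool using (Bool; true; false; not; if_then_else_)
import Data.Bool.Properties as Boolₚ
open import Data.List as List using (List; []; _∷_; filter)
open import Data.List.Properties using (filter-accept; filter-reject)
open import Data.List.Relation.Unary.All using (All; []; _∷_)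
import Data.List.Relation.Unary.All.Properties as Allₚ
import Data.List.Relation.Unary.AllPairs as AllPairs
open import Data.List.Relation.Unary.Linked as Linked using (Linked; []; [-]; _∷_)
import Data.List.Relation.Unary.Linked.Properties as Linkedₚ
open import Data.Nat using (zero; suc; z≤n; s≤s)
open import Data.Nat.Properties
open import Algebra.Properties.CommutativeSemigroup +-commutativeSemigroup using (interchange)
open import Data.Nat.Tactic.RingSolver using (solve-∀)
open import Data.Product using (_×_; _,_; proj₁; proj₂; ∃)
open import Data.Sum using (_⊎_; inj₁; inj₂)
open import Data.Vec as Vec using (Vec; []; _∷_)
import Data.Vec.Properties as Vecₚ
import Data.Vec.Relation.Binary.Pointwise.Inductive as Pointwise
open Pointwise using (Pointwise)
open import Function using (_on_; _∘_)
open import Level using (0ℓ)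
open import Relation.Binary.Core using (Rel)
open import Relation.Binary.Definitions using (Decidable; DecidableEquality; Transitive)
open import Relation.Binary.PropositionalEquality
open import Relation.Nullary using (¬_; Dec; yes; no; ¬?; contradiction)
open import Relation.Nullary.Decidable using (isYes; _×-dec_; _⊎-dec_)

private
  variable
    A B : Set

indicator : ∀ {P : Set} → Dec P → ℕ
indicator p = if isYes p then 1 else 0

indicator-mono : ∀ {P Q : Set} → (P → Q) → (p : Dec P) (q : Dec Q) → indicator p ≤ indicator q
indicator-mono P⇒Q (yes p) (yes q) = ≤-refl
indicator-mono P⇒Q (yes p) (no ¬q) = contradiction (P⇒Q p) ¬q
indicator-mono P⇒Q (no ¬p) q       = z≤n

indicator-⊎ : ∀ {P Q : Set} (p : Dec P) (q : Dec Q) → indicator (p ⊎-dec q) ≤ indicator p + indicator q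
indicator-⊎ (yes p) q      = s≤s z≤n
indicator-⊎ (no ¬p) (yes q) = ≤-refl
indicator-⊎ (no ¬p) (no ¬q) = z≤n

indicator-¬ : ∀ {P : Set} → ¬ P → (p : Dec P) → indicator p ≡ 0
indicator-¬ ¬p (yes p) = contradiction p ¬p
indicator-¬ ¬p (no _)  = refl

module _ {R : Rel A 0ℓ} (R? : Decidable R) where

  steps : List A → ℕ
  steps (a ∷ b ∷ l) = indicator (R? a b) + steps (b ∷ l)
  steps _           = 0

  steps-∷ : ∀ a l → steps l ≤ steps (a ∷ l)
  steps-∷ a []      = z≤n
  steps-∷ a (b ∷ l) = m≤n+m (steps (b ∷ l)) (indicator (R? a b))

steps-mono : ∀ {Q R S : Rel A 0ℓ} (R? : Decidable R) (S? : Decidable S) →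
             (∀ {a b} → Q a b → R a b → S a b) → ∀ {l} → Linked Q l → steps R? l ≤ steps S? l
steps-mono R? S? R⇒S []       = z≤n
steps-mono R? S? R⇒S [-]      = z≤n
steps-mono R? S? R⇒S (q ∷ qs) = +-mono-≤ (indicator-mono (R⇒S q) (R? _ _) (S? _ _)) (steps-mono R? S? R⇒S qs)

steps-⊎ : ∀ {R S : Rel A 0ℓ} (R? : Decidable R) (S? : Decidable S) l →
          steps (λ a b → R? a b ⊎-dec S? a b) l ≤ steps R? l + steps S? l
steps-⊎ R? S? []          = z≤n
steps-⊎ R? S? (a ∷ [])    = z≤n
steps-⊎ R? S? (a ∷ b ∷ l) = begin
  indicator (R? a b ⊎-dec S? a b) + steps _ (b ∷ l)
    ≤⟨ +-mono-≤ (indicator-⊎ (R? a b) (S? a b)) (steps-⊎ R? S? (b ∷ l)) ⟩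
  (indicator (R? a b) + indicator (S? a b)) + (steps R? (b ∷ l) + steps S? (b ∷ l))
    ≡⟨ interchange (indicator (R? a b)) (indicator (S? a b)) (steps R? (b ∷ l)) (steps S? (b ∷ l)) ⟩
  steps R? (a ∷ b ∷ l) + steps S? (a ∷ b ∷ l) ∎
  where open ≤-Reasoning

steps-map : ∀ {R : Rel B 0ℓ} (R? : Decidable R) (f : A → B) l →
            steps (λ a b → R? (f a) (f b)) l ≡ steps R? (List.map f l)
steps-map R? f []          = refl
steps-map R? f (a ∷ [])    = refl
steps-map R? f (a ∷ b ∷ l) = cong (indicator (R? (f a) (f b)) +_) (steps-map R? f (b ∷ l))

steps-empty : ∀ {R : Rel A 0ℓ} (R? : Decidable R) → (∀ {a b} → ¬ R a b) → ∀ l → steps R? l ≡ 0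
steps-empty R? ¬R []          = refl
steps-empty R? ¬R (a ∷ [])    = refl
steps-empty R? ¬R (a ∷ b ∷ l) = cong₂ _+_ (indicator-¬ ¬R (R? a b)) (steps-empty R? ¬R (b ∷ l))

agree? : DecidableEquality B → (f : A → B) → Decidable (_≡_ on f)
agree? _≟_ f a b = f a ≟ f b

differ? : DecidableEquality B → (f : A → B) → Decidable (_≢_ on f)
differ? _≟_ f a b = ¬? (f a ≟ f b)

Drop : (A → Bool) → Rel A 0ℓ
Drop y a b = y a ≡ true × y b ≡ false

drop? : (y : A → Bool) → Decidable (Drop y)
drop? y a b = (y a Bool.≟ true) ×-dec (y b Bool.≟ false)

module _ (y : A → Bool) where

  -- Changes alternate between rises and drops; the value y a decides whether a rise can come first.
  private
    changes+start≤2*drops+1 : ∀ a l →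
      steps (differ? Bool._≟_ y) (a ∷ l) + (if y a then 1 else 0) ≤ 2 * steps (drop? y) (a ∷ l) + 1
    changes+start≤2*drops+1 a [] with y a
    ... | true  = ≤-refl
    ... | false = z≤n
    changes+start≤2*drops+1 a (b ∷ l) with y a | y b | changes+start≤2*drops+1 b l
    ... | true  | true  | ih = ih
    ... | false | false | ih = ih
    ... | false | true  | ih =
      subst (_≤ 2 * steps (drop? y) (b ∷ l) + 1)
            (trans (+-comm (steps (differ? Bool._≟_ y) (b ∷ l)) 1) (sym (+-identityʳ _))) ih
    ... | true  | false | ih = begin
      suc (s + 1)           ≡⟨ cong suc (+-comm s 1) ⟩
      2 + s                 ≡⟨ cong (2 +_) (+-identityʳ s) ⟨
      2 + (s + 0)           ≤⟨ +-monoʳ-≤ 2 ih ⟩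
      2 + (2 * d + 1)       ≡⟨ +-assoc 2 (2 * d) 1 ⟨
      2 + 2 * d + 1         ≡⟨ cong (_+ 1) (*-distribˡ-+ 2 1 d) ⟨
      2 * (1 + d) + 1       ∎
      where
      open ≤-Reasoning
      s d : ℕ
      s = steps (differ? Bool._≟_ y) (b ∷ l)
      d = steps (drop? y) (b ∷ l)

  changes≤2*drops+1 : ∀ l → steps (differ? Bool._≟_ y) l ≤ 2 * steps (drop? y) l + 1
  changes≤2*drops+1 []      = z≤n
  changes≤2*drops+1 (a ∷ l) = ≤-trans (m≤m+n _ _) (changes+start≤2*drops+1 a l)

class : (A → Bool) → Bool → List A → List A
class c v = filter (λ a → c a Bool.≟ v)

module _ {R : Rel A 0ℓ} (R? : Decidable R) (c : A → Bool)
         (R⇒same-class : ∀ {a b} → R a b → c a ≡ c b) where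

  private
    steps-split-∷ : ∀ {v} a l → c a ≡ v →
                    steps R? (a ∷ l) ≤ steps R? (a ∷ class c v l) + steps R? (class c (not v) l)
    steps-split-∷ a []      _    = z≤n
    steps-split-∷ {v} a (b ∷ l) ca≡v with c b Bool.≟ v
    ... | yes cb≡v
      rewrite filter-reject (λ x → c x Bool.≟ not v) {xs = l} (Boolₚ.not-¬ cb≡v) = begin
      indicator (R? a b) + steps R? (b ∷ l)
        ≤⟨ +-monoʳ-≤ (indicator (R? a b)) (steps-split-∷ b l cb≡v) ⟩
      indicator (R? a b) + (steps R? (b ∷ class c v l) + steps R? (class c (not v) l))
        ≡⟨ +-assoc (indicator (R? a b)) _ _ ⟨
      steps R? (a ∷ b ∷ class c v l) + steps R? (class c (not v) l) ∎
      where open ≤-Reasoning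
    ... | no cb≢v
      rewrite filter-accept (λ x → c x Bool.≟ not v) {xs = l} (Boolₚ.¬-not cb≢v) = begin
      indicator (R? a b) + steps R? (b ∷ l)
        ≡⟨ cong (_+ steps R? (b ∷ l)) (indicator-¬ (λ r → cb≢v (trans (sym (R⇒same-class r)) ca≡v)) _) ⟩
      steps R? (b ∷ l)
        ≤⟨ steps-split-∷ b l (Boolₚ.¬-not cb≢v) ⟩
      steps R? (b ∷ class c (not v) l) + steps R? (class c (not (not v)) l)
        ≡⟨ cong (λ u → steps R? (b ∷ class c (not v) l) + steps R? (class c u l)) (Boolₚ.not-involutive v) ⟩
      steps R? (b ∷ class c (not v) l) + steps R? (class c v l)
        ≤⟨ +-monoʳ-≤ (steps R? (b ∷ class c (not v) l)) (steps-∷ R? a (class c v l)) ⟩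
      steps R? (b ∷ class c (not v) l) + steps R? (a ∷ class c v l)
        ≡⟨ +-comm (steps R? (b ∷ class c (not v) l)) _ ⟩
      steps R? (a ∷ class c v l) + steps R? (b ∷ class c (not v) l) ∎
      where open ≤-Reasoning

  steps-split : ∀ v l → steps R? l ≤ steps R? (class c v l) + steps R? (class c (not v) l)
  steps-split v []      = z≤n
  steps-split v (a ∷ l) with c a Bool.≟ v
  ... | yes ca≡v
    rewrite filter-reject (λ x → c x Bool.≟ not v) {xs = l} (Boolₚ.not-¬ ca≡v) = steps-split-∷ a l ca≡v
  ... | no ca≢v
    rewrite filter-accept (λ x → c x Bool.≟ not v) {xs = l} (Boolₚ.¬-not ca≢v) = begin
    steps R? (a ∷ l)
      ≤⟨ steps-split-∷ a l (Boolₚ.¬-not ca≢v) ⟩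
    steps R? (a ∷ class c (not v) l) + steps R? (class c (not (not v)) l)
      ≡⟨ cong (λ u → steps R? (a ∷ class c (not v) l) + steps R? (class c u l)) (Boolₚ.not-involutive v) ⟩
    steps R? (a ∷ class c (not v) l) + steps R? (class c v l)
      ≡⟨ +-comm (steps R? (a ∷ class c (not v) l)) _ ⟩
    steps R? (class c v l) + steps R? (a ∷ class c (not v) l) ∎
    where open ≤-Reasoning

Linked-agree : ∀ {Q : Rel A 0ℓ} (f : A → B) {v l} →
               Linked Q l → All (λ a → f a ≡ v) l → Linked (λ a b → Q a b × f a ≡ f b) l
Linked-agree f []       _                  = []
Linked-agree f [-]      _                  = [-]
Linked-agree f (q ∷ qs) (fa ∷ fbs@(fb ∷ _)) = (q , trans fa (sym fb)) ∷ Linked-agree f qs fbs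

∩-agree-trans : ∀ {Q : Rel A 0ℓ} (f : A → B) → Transitive Q → Transitive (λ a b → Q a b × f a ≡ f b)
∩-agree-trans f Q-trans (q₁ , e₁) (q₂ , e₂) = Q-trans q₁ q₂ , trans e₁ e₂

_≟ᵥ_ : ∀ {n} → DecidableEquality (Vec Bool n)
_≟ᵥ_ = Vecₚ.≡-dec Bool._≟_

double-* : ∀ k p → k * p + k * p ≡ k * (2 * p)
double-* = solve-∀

module _ (y : A → Bool) (K : ℕ) where

  -- Splitting off the first key bit: pairs with equal keys stay consecutive within their class, and
  -- each class is again Q-linked and has a constant first bit.
  changes-within-classes :
    ∀ w (κ : A → Vec Bool w) {Q : Rel A 0ℓ} → Transitive Q →
    (∀ {l} → Linked (λ a b → Q a b × κ a ≡ κ b) l → steps (differ? Bool._≟_ y) l ≤ K) →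
    ∀ {l} → Linked Q l →
    steps (λ a b → agree? _≟ᵥ_ κ a b ×-dec differ? Bool._≟_ y a b) l ≤ K * 2 ^ w
  changes-within-classes zero κ Q-trans bound {l} ql = begin
    steps _ l                        ≤⟨ steps-mono _ (differ? Bool._≟_ y) (λ _ → proj₂) ql ⟩
    steps (differ? Bool._≟_ y) l     ≤⟨ bound (Linked.map (λ q → q , empty-unique _ _) ql) ⟩
    K                                ≡⟨ *-identityʳ K ⟨
    K * 1                            ∎
    where
    open ≤-Reasoning
    empty-unique : (u v : Vec Bool 0) → u ≡ v
    empty-unique [] [] = refl
  changes-within-classes (suc w) κ {Q} Q-trans bound {l} ql = begin
    steps R? l
      ≤⟨ steps-split R? head-κ (λ (e , _) → cong Vec.head e) true l ⟩
    steps R? (part true) + steps R? (part false)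
      ≤⟨ +-mono-≤ (within-class true) (within-class false) ⟩
    K * 2 ^ w + K * 2 ^ w
      ≡⟨ double-* K (2 ^ w) ⟩
    K * 2 ^ suc w ∎
    where
    open ≤-Reasoning
    head-κ : A → Bool
    head-κ a = Vec.head (κ a)
    tail-κ : A → Vec Bool w
    tail-κ a = Vec.tail (κ a)
    R? : Decidable (λ a b → κ a ≡ κ b × y a ≢ y b)
    R? a b = agree? _≟ᵥ_ κ a b ×-dec differ? Bool._≟_ y a b
    part : Bool → List A
    part v = class head-κ v l
    head-tail-injective : ∀ (u v : Vec Bool (suc w)) →
                          Vec.head u ≡ Vec.head v → Vec.tail u ≡ Vec.tail v → u ≡ v
    head-tail-injective (x ∷ u) (x′ ∷ v) = cong₂ _∷_
    Q′ : Rel A 0ℓ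
    Q′ a b = Q a b × head-κ a ≡ head-κ b
    within-class : ∀ v → steps R? (part v) ≤ K * 2 ^ w
    within-class v = begin
      steps R? (part v)
        ≤⟨ steps-mono R? _ (λ _ (e , d) → cong Vec.tail e , d) linked ⟩
      steps _ (part v)
        ≤⟨ changes-within-classes w tail-κ (∩-agree-trans head-κ Q-trans)
             (λ ql′ → bound (Linked.map (λ ((q , eh) , et) → q , head-tail-injective _ _ eh et) ql′)) linked ⟩
      K * 2 ^ w ∎
      where
      linked : Linked Q′ (part v)
      linked = Linked-agree head-κ (Linkedₚ.filter⁺ _ Q-trans ql) (Allₚ.all-filter _ l)

module _ {Q J : Rel A 0ℓ} (_≟_ : DecidableEquality A) (J? : Decidable J) (J-irreflexive : ∀ {a} → ¬ J a a) where

  -- IsChain requires distinct elements; equal neighbours never form a J-step, so they can be dropped.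
  remove-repeats : ∀ a l → Linked Q (a ∷ l) →
                   ∃ λ l′ → Linked (λ a b → Q a b × a ≢ b) (a ∷ l′)
                          × steps J? (a ∷ l) ≤ steps J? (a ∷ l′)
  remove-repeats a []      _        = [] , [-] , z≤n
  remove-repeats a (b ∷ l) (q ∷ ql) with remove-repeats b l ql | a ≟ b
  ... | l′ , ql′ , le | yes refl =
    l′ , ql′ , ≤-trans (≤-reflexive (cong (_+ steps J? (a ∷ l)) (indicator-¬ J-irreflexive (J? a a)))) le
  ... | l′ , ql′ , le | no a≢b   = b ∷ l′ , (q , a≢b) ∷ ql′ , +-monoʳ-≤ (indicator (J? a b)) le

≤ᵥ-antisym : ∀ {n} {a b : Vec Bool n} → a ≤ᵥ b → b ≤ᵥ a → a ≡ b
≤ᵥ-antisym Pointwise.[]       Pointwise.[]       = refl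
≤ᵥ-antisym (p Pointwise.∷ ps) (q Pointwise.∷ qs) = cong₂ _∷_ (Boolₚ.≤-antisym p q) (≤ᵥ-antisym ps qs)

module _ {n : ℕ} where

  ≤ᵥ-trans : Transitive (_≤ᵥ_ {n})
  ≤ᵥ-trans = Pointwise.trans Boolₚ.≤-trans

  _<ᵥ_ : Rel (Vec Bool n) 0ℓ
  a <ᵥ b = a ≤ᵥ b × a ≢ b

  <ᵥ-trans : Transitive _<ᵥ_
  <ᵥ-trans (ab , a≢b) (bc , b≢c) =
    ≤ᵥ-trans ab bc , λ { refl → a≢b (≤ᵥ-antisym ab bc) }

  strictly-increasing⇒IsChain : ∀ {C} → Linked _<ᵥ_ C → IsChain C
  strictly-increasing⇒IsChain lk = AllPairs.map proj₂ (Linkedₚ.Linked⇒AllPairs <ᵥ-trans lk) , Linked.map proj₁ lk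

dC≡steps : ∀ {n m} (F : System n m) C → dC F C ≡ steps (isJumpSys? F) C
dC≡steps F []          = refl
dC≡steps F (a ∷ [])    = refl
dC≡steps F (a ∷ b ∷ C) = cong (indicator (isJumpSys? F a b) +_) (dC≡steps F (b ∷ C))

jump-irreflexive : ∀ {n m} (F : System n m) {a} → ¬ IsJumpSys F a a
jump-irreflexive F (_ , _ , t , f) = contradiction (trans (sym t) f) λ ()

jumps≤decrease : ∀ {n m} (F : System n m) {d} → IsDecrease F d →
                 ∀ {l} → Linked _≤ᵥ_ l → steps (isJumpSys? F) l ≤ d
jumps≤decrease F _               {[]}    _  = z≤n
jumps≤decrease F (_ , maximal) {a ∷ l} ql with remove-repeats _≟ᵥ_ (isJumpSys? F) (jump-irreflexive F) a l ql
... | l′ , ql′ , le = begin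
  steps (isJumpSys? F) (a ∷ l)    ≤⟨ le ⟩
  steps (isJumpSys? F) (a ∷ l′)   ≡⟨ dC≡steps F (a ∷ l′) ⟨
  dC F (a ∷ l′)                   ≤⟨ maximal (a ∷ l′) (strictly-increasing⇒IsChain ql′) ⟩
  _ ∎
  where open ≤-Reasoning

changes≤2*decrease+1 : ∀ {k} (g : BF k) {d} → IsDecrease {m = 1} (λ _ → g) d →
                       ∀ {l} → Linked _≤ᵥ_ l → steps (differ? Bool._≟_ g) l ≤ 2 * d + 1
changes≤2*decrease+1 g {d} dec {l} ql = begin
  steps (differ? Bool._≟_ g) l               ≤⟨ changes≤2*drops+1 g l ⟩
  2 * steps (drop? g) l + 1                  ≤⟨ +-monoˡ-≤ 1 (*-monoʳ-≤ 2 drops≤d) ⟩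
  2 * d + 1                                  ∎
  where
  open ≤-Reasoning
  drops≤d : steps (drop? g) l ≤ d
  drops≤d = ≤-trans (steps-mono (drop? g) (isJumpSys? (λ _ → g)) (λ a≤b drop → Fin.zero , a≤b , drop) ql)
                    (jumps≤decrease (λ _ → g) dec ql)

++-differ : ∀ {m k} → DecidableEquality A → {u v : Vec A m} {x y : Vec A k} →
            u Vec.++ x ≢ v Vec.++ y → u ≢ v ⊎ (u ≡ v × x ≢ y)
++-differ _≟_ {u} {v} ne with Vecₚ.≡-dec _≟_ u v
... | yes refl = inj₂ (refl , λ { refl → ne refl })
... | no u≢v   = inj₁ u≢v

∷ʳ⁺ : ∀ {R : Rel A 0ℓ} {n} {u v : Vec A n} {x y} →
      Pointwise R u v → R x y → Pointwise R (u Vec.∷ʳ x) (v Vec.∷ʳ y)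
∷ʳ⁺ Pointwise.[]       r = r Pointwise.∷ Pointwise.[]
∷ʳ⁺ (p Pointwise.∷ ps) r = p Pointwise.∷ ∷ʳ⁺ ps r

map-lookup⁺ : ∀ {R : Rel A 0ℓ} {j k} {u v : Vec A j} → Pointwise R u v → (is : Vec (Fin j) k) →
              Pointwise R (Vec.map (Vec.lookup u) is) (Vec.map (Vec.lookup v) is)
map-lookup⁺ p []       = Pointwise.[]
map-lookup⁺ p (i ∷ is) = Pointwise.lookup p i Pointwise.∷ map-lookup⁺ p is

module _ (Bs : Basis) where
  open Basis Bs

  gateSignature : ∀ {k} (g : GateFun Bs k) → Vec Bool k → Vec Bool (gateWeight Bs g)
  gateSignature (mono _ _) u = []
  gateSignature (omega i)  u = ω i u ∷ []

  gate-monotone-on-signature : ∀ {k} (g : GateFun Bs k) {u v} → u ≤ᵥ v →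
                               gateSignature g u ≡ gateSignature g v → gateEval Bs g u Bool.≤ gateEval Bs g v
  gate-monotone-on-signature (mono g g-mono) u≤v _ = g-mono _ _ u≤v
  gate-monotone-on-signature (omega i)       _   e = Boolₚ.≤-reflexive (Vecₚ.∷-injectiveˡ e)

  gateInputs : ∀ {n j k} → Circuit Bs n j → Vec (Fin j) k → Vec Bool n → Vec Bool k
  gateInputs c is x = Vec.map (Vec.lookup (values Bs c x)) is

  signature : ∀ {n j} (c : Circuit Bs n j) → Vec Bool n → Vec Bool (weight Bs c)
  signature inputs           x = []
  signature (c ▷ gate _ g is) x = signature c x Vec.++ gateSignature g (gateInputs c is x)

  values-monotone-on-signature : ∀ {n j} (c : Circuit Bs n j) {a b} → a ≤ᵥ b →
                                 signature c a ≡ signature c b → values Bs c a ≤ᵥ values Bs c b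
  values-monotone-on-signature inputs            a≤b _ = a≤b
  values-monotone-on-signature (c ▷ gate _ g is) {a} {b} a≤b e =
    ∷ʳ⁺ values≤ (gate-monotone-on-signature g (map-lookup⁺ values≤ is) (Vecₚ.++-injectiveʳ _ _ e))
    where
    values≤ : values Bs c a ≤ᵥ values Bs c b
    values≤ = values-monotone-on-signature c a≤b (Vecₚ.++-injectiveˡ _ _ e)

  jump⇒signature-differs : ∀ {n j m} (c : Circuit Bs n j) {F : System n m} → Realizes Bs c F →
                           ∀ {a b} → IsJumpSys F a b → signature c a ≢ signature c b
  jump⇒signature-differs c realizes {a} {b} (t , a≤b , Fa≡true , Fb≡false) e with realizes t
  ... | v , computes = true≰false (subst₂ Bool._≤_ (trans (computes a) Fa≡true) (trans (computes b) Fb≡false)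
                                           (Pointwise.lookup (values-monotone-on-signature c a≤b e) v))
    where
    true≰false : ¬ true Bool.≤ false
    true≰false ()

  module _ (K : ℕ) (ω-changes≤ : ∀ i {l} → Linked _≤ᵥ_ l → steps (differ? Bool._≟_ (ω i)) l ≤ K) where

    gate-signature-changes :
      ∀ {n j k} (c : Circuit Bs n j) (g : GateFun Bs k) (is : Vec (Fin j) k) {l} → Linked _≤ᵥ_ l →
      steps (λ a b → agree? _≟ᵥ_ (signature c) a b
                     ×-dec differ? _≟ᵥ_ (gateSignature g ∘ gateInputs c is) a b) l
        + K * 2 ^ weight Bs c
      ≤ K * 2 ^ (weight Bs c + gateWeight Bs g)
    gate-signature-changes c (mono _ _) is {l} _ = begin
      steps _ l + K * 2 ^ w  ≡⟨ cong (_+ K * 2 ^ w) (steps-empty _ (λ (_ , ne) → ne refl) l) ⟩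
      K * 2 ^ w              ≡⟨ cong (λ e → K * 2 ^ e) (+-identityʳ w) ⟨
      K * 2 ^ (w + 0)        ∎
      where
      open ≤-Reasoning
      w : ℕ
      w = weight Bs c
    gate-signature-changes c (omega i) is {l} ql = begin
      steps _ l + K * 2 ^ w
        ≤⟨ +-monoˡ-≤ (K * 2 ^ w) (steps-mono _ _ (λ _ (e , ne) → e , λ y≡ → ne (cong (_∷ []) y≡)) ql) ⟩
      steps (λ a b → agree? _≟ᵥ_ (signature c) a b ×-dec differ? Bool._≟_ y a b) l + K * 2 ^ w
        ≤⟨ +-monoˡ-≤ (K * 2 ^ w) (changes-within-classes y K w (signature c) ≤ᵥ-trans y-changes≤ ql) ⟩
      K * 2 ^ w + K * 2 ^ w
        ≡⟨ double-* K (2 ^ w) ⟩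
      K * 2 ^ suc w
        ≡⟨ cong (λ e → K * 2 ^ e) (+-comm 1 w) ⟩
      K * 2 ^ (w + 1) ∎
      where
      open ≤-Reasoning
      w : ℕ
      w = weight Bs c
      y : Vec Bool _ → Bool
      y = ω i ∘ gateInputs c is
      y-changes≤ : ∀ {l′} → Linked (λ a b → a ≤ᵥ b × signature c a ≡ signature c b) l′ →
                   steps (differ? Bool._≟_ y) l′ ≤ K
      y-changes≤ {l′} ql′ = begin
        steps (differ? Bool._≟_ y) l′
          ≡⟨ steps-map (differ? Bool._≟_ (ω i)) (gateInputs c is) l′ ⟩
        steps (differ? Bool._≟_ (ω i)) (List.map (gateInputs c is) l′)
          ≤⟨ ω-changes≤ i (Linkedₚ.map⁺ (Linked.map inputs≤ ql′)) ⟩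
        K ∎
        where
        inputs≤ : ∀ {a b} → a ≤ᵥ b × signature c a ≡ signature c b → gateInputs c is a ≤ᵥ gateInputs c is b
        inputs≤ (a≤b , e) = map-lookup⁺ (values-monotone-on-signature c a≤b e) is

    signature-changes : ∀ {n j} (c : Circuit Bs n j) {l} → Linked _≤ᵥ_ l →
                        steps (differ? _≟ᵥ_ (signature c)) l + K ≤ K * 2 ^ weight Bs c
    signature-changes inputs {l} _ = begin
      steps _ l + K  ≡⟨ cong (_+ K) (steps-empty _ (λ ne → ne refl) l) ⟩
      K              ≡⟨ *-identityʳ K ⟨
      K * 1          ∎
      where open ≤-Reasoning
    signature-changes (c ▷ gate _ g is) {l} ql = begin
      steps (differ? _≟ᵥ_ (signature (c ▷ gate _ g is))) l + K
        ≤⟨ +-monoˡ-≤ K (steps-mono _ _ (λ _ → ++-differ Bool._≟_) ql) ⟩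
      steps (λ a b → old-changes? a b ⊎-dec gate-changes? a b) l + K
        ≤⟨ +-monoˡ-≤ K (steps-⊎ old-changes? gate-changes? l) ⟩
      steps old-changes? l + steps gate-changes? l + K
        ≡⟨ swap-+ (steps old-changes? l) (steps gate-changes? l) K ⟩
      steps gate-changes? l + (steps old-changes? l + K)
        ≤⟨ +-monoʳ-≤ (steps gate-changes? l) (signature-changes c ql) ⟩
      steps gate-changes? l + K * 2 ^ weight Bs c
        ≤⟨ gate-signature-changes c g is ql ⟩
      K * 2 ^ (weight Bs c + gateWeight Bs g) ∎
      where
      open ≤-Reasoning
      swap-+ : ∀ s t u → s + t + u ≡ t + (s + u)
      swap-+ = solve-∀
      old-changes? : Decidable (λ a b → signature c a ≢ signature c b)
      old-changes? = differ? _≟ᵥ_ (signature c)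
      gate-changes? : Decidable (λ a b → signature c a ≡ signature c b ×
                                         gateSignature g (gateInputs c is a) ≢ gateSignature g (gateInputs c is b))
      gate-changes? a b = agree? _≟ᵥ_ (signature c) a b ×-dec differ? _≟ᵥ_ (gateSignature g ∘ gateInputs c is) a b

maxFin-upper : ∀ {p} (f : Fin p → ℕ) i → f i ≤ maxFin f
maxFin-upper f Fin.zero    = m≤m⊔n _ _
maxFin-upper f (Fin.suc i) = ≤-trans (maxFin-upper (f ∘ Fin.suc) i) (m≤n⊔m _ _)

+≤*⇒≤*∸1 : ∀ d k p → d + k ≤ k * p → d ≤ k * (p ∸ 1)
+≤*⇒≤*∸1 d k p le rewrite *-distribˡ-∸ k p 1 | *-identityʳ k = m+n≤o⇒m≤o∸n d le

lemma1 : (Bs : Basis) (ds : Fin (Basis.p Bs) → ℕ)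
         → (∀ i → IsSingleDecrease Bs i (ds i))
         → ∀ n m (F : System n m) (d k : ℕ)
         → IsDecrease F d → IsInvComplexity Bs F k
         → d ≤ (2 * maxFin ds + 1) * (2 ^ k ∸ 1)
lemma1 Bs ds ds-decrease n m F d k ((C , (_ , C-linked) , dC≡d) , _) ((_ , c , realizes , weight≡k) , _) =
  +≤*⇒≤*∸1 d K (2 ^ k) (begin
    d + K                                       ≡⟨ cong (_+ K) (trans (sym dC≡d) (dC≡steps F C)) ⟩
    steps (isJumpSys? F) C + K                  ≤⟨ +-monoˡ-≤ K jumps≤signature-changes ⟩
    steps (differ? _≟ᵥ_ (signature Bs c)) C + K ≤⟨ signature-changes Bs K ω-changes≤ c C-linked ⟩
    K * 2 ^ weight Bs c                         ≡⟨ cong (λ e → K * 2 ^ e) weight≡k ⟩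
    K * 2 ^ k                                   ∎)
  where
  open ≤-Reasoning
  K : ℕ
  K = 2 * maxFin ds + 1
  ω-changes≤ : ∀ i {l} → Linked _≤ᵥ_ l → steps (differ? Bool._≟_ (Basis.ω Bs i)) l ≤ K
  ω-changes≤ i ql = ≤-trans (changes≤2*decrease+1 (Basis.ω Bs i) (ds-decrease i) ql)
                            (+-monoˡ-≤ 1 (*-monoʳ-≤ 2 (maxFin-upper ds i)))
  jumps≤signature-changes : steps (isJumpSys? F) C ≤ steps (differ? _≟ᵥ_ (signature Bs c)) C
  jumps≤signature-changes = steps-mono _ _ (λ _ → jump⇒signature-differs Bs c realizes) C-linked
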